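{- If $G$ is a graph with $n$ vertices, then $\mathrm{cat}(G)\leq \mathrm{cutwidth}(G)\,\lceil\log_2 n\rceil$.
   Context: Cat Herding is a two-player game on a finite simple graph $G$ between a cat and a herder. First the cat places its token on a starting vertex. Then the players alternate, the herder moving first: on the herder's turn it deletes one edge of the current graph (a "cut"); on the cat's turn the cat must move its token along a path of the current graph to a different vertex. The game ends when the cat's current vertex has no incident edges. The score is the total number of edges deleted; the herder minimizes and the cat maximizes it. For $v\in V(G)$, $\mathrm{cat}(G,v)$ is the optimal-play score when the cat starts at $v$, and $\mathrm{cat}(G)=\max_{v\in V(G)}\mathrm{cat}(G,v)$. For disjoint vertex sets $A,B$, $[A,B]$ denotes the set of edges with one end in $A$ and the other in $B$. For an ordering $I=(v_1,\dots,v_n)$ of $V(G)$, $wd(G,I)=\max_i |[\{v_1,\dots,v_i\},\{v_{i+1},\dots,v_n\}]|$, and $\mathrm{cutwidth}(G)=\min_I wd(G,I)$ over all orderings $I$. -}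

module Defs where

open import Data.Nat using (ℕ; zero; suc; _<ᵇ_; _≤ᵇ_; _⊔_)
open import Data.Bool using (Bool; true; false; _∧_; _∨_; not; if_then_else_)
open import Data.Fin using (Fin; toℕ; _≟_)
open import Data.Fin.Permutation using (Permutation′; _⟨$⟩ˡ_)
open import Data.List using (List; map; foldr; upTo; allFin)
open import Data.Nat.ListAction using (sum)
open import Relation.Nullary.Decidable using (⌊_⌋)
open import Relation.Binary.PropositionalEquality using (_≡_; _≢_)

Adj : ℕ → Set
Adj n = Fin n → Fin n → Bool

record Graph (n : ℕ) : Set where
  field
    adj   : Adj n
    sym   : ∀ x y → adj x y ≡ adj y x
    loopless : ∀ x → adj x x ≡ false
open Graph public

removeEdge : ∀ {n} → Fin n → Fin n → Adj n → Adj n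
removeEdge a b A x y =
  A x y ∧ not ((⌊ x ≟ a ⌋ ∧ ⌊ y ≟ b ⌋) ∨ (⌊ x ≟ b ⌋ ∧ ⌊ y ≟ a ⌋))

data Reach {n} (A : Adj n) : Fin n → Fin n → Set where
  here : ∀ {x} → Reach A x x
  step : ∀ {x y z} → A x y ≡ true → Reach A y z → Reach A x z

-- HerderWins k A v : cat is at v, herder to move, current graph A;
-- the herder can guarantee that at most k further edges are deleted.
data HerderWins {n} : ℕ → Adj n → Fin n → Set where
  done : ∀ {k A v} → (∀ w → A v w ≡ false) → HerderWins k A v
  -- herder deletes an edge {a,b}; then the cat moves to any other vertex
  -- reachable in the new graph (if none, the game is over)
  cut  : ∀ {k A v} (a b : Fin n) → A a b ≡ true →
         (∀ w → w ≢ v → Reach (removeEdge a b A) v w →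
            HerderWins k (removeEdge a b A) w) →
         HerderWins (suc k) A v

CatAtMost : ∀ {n} → Graph n → ℕ → Set
CatAtMost G k = ∀ v → HerderWins k (adj G) v

-- An ordering I = (v_1,…,v_n) given by a permutation; π ⟨$⟩ˡ x is the
-- (0-based) position of vertex x. Number of edges between the first i
-- vertices and the rest:
cutSize : ∀ {n} → Graph n → Permutation′ n → ℕ → ℕ
cutSize {n} G π i =
  sum (map (λ x → sum (map (λ y →
      if adj G x y ∧ (toℕ (π ⟨$⟩ˡ x) <ᵇ i) ∧ (i ≤ᵇ toℕ (π ⟨$⟩ˡ y))
      then 1 else 0) (allFin n))) (allFin n))

wd : ∀ {n} → Graph n → Permutation′ n → ℕ
wd {n} G π = foldr _⊔_ 0 (map (λ i → cutSize G π (suc i)) (upTo n))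

open import Data.Product using (Σ; _×_)
open import Data.Nat using (_≤_)

IsCutwidth : ∀ {n} → Graph n → ℕ → Set
IsCutwidth {n} G c = Σ (Permutation′ n) (λ π → wd G π ≡ c) × (∀ π → c ≤ wd G π)

{-# OPTIONS --safe #-}
-- Fix an ordering of width c and keep the cat confined to an interval of consecutive
-- positions whose edges do not leave it.  The herder deletes, one at a time, the at most c
-- edges crossing the midpoint of the interval; the cat cannot leave the interval meanwhile,
-- and once no edge crosses the midpoint it is trapped in one half.  Hence an interval of at
-- most 2^k positions costs at most c·k cuts, and an interval of one position holds an
-- isolated vertex.
module Submission where

open import Defs
open import Data.Nat using (ℕ; _*_)
open import Data.Nat.Logarithm using (⌈log₂_⌉)

open import Data.Bool using (Bool; true; false; _∧_; _∨_; not; if_then_else_)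
open import Data.Bool.Properties using (∧-comm; ∨-comm; ∧-zeroʳ; ∧-conicalˡ; ∧-conicalʳ; ¬-not; T-≡)
open import Data.Fin using (Fin; toℕ; _≟_)
open import Data.Fin.Properties using (toℕ-injective; toℕ<n)
open import Data.Fin.Permutation using (Permutation′; _⟨$⟩ˡ_; _⟨$⟩ʳ_; inverseʳ)
open import Data.List using ([]; _∷_; map; allFin)
open import Data.List.Membership.Propositional using (_∈_)
open import Data.List.Membership.Propositional.Properties using (∈-allFin)
open import Data.List.Properties using (foldr-preservesᵒ)
open import Data.List.Relation.Unary.Any using (here; there)
import Data.List.Relation.Unary.Any.Properties as Any
open import Data.Nat using (zero; suc; _+_; _^_; _≤_; _<_; z≤n; s≤s; z<s; _<ᵇ_; _≤ᵇ_; ⌈_/2⌉)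
open import Data.Nat.ListAction using (sum)
open import Data.Nat.Logarithm.Core using (⌈log2⌉)
open import Data.Nat.Properties
  using (≤-refl; ≤-reflexive; <⇒≢; ≤-trans; ≤-antisym; <-≤-trans; <⇒≤; _≤?_; _<?_; ≰⇒>; ≮⇒≥;
         n≤1+n; n≤0⇒n≡0; n≢0⇒n>0; m≤m+n; m≤n+m; m≤n⇒m≤n⊔o; m≤n⇒m≤o⊔n; m<1+n⇒m≤n;
         +-mono-≤; +-mono-<-≤; +-mono-≤-<; +-comm; +-assoc; +-identityʳ; *-suc; *-monoʳ-≤;
         m^n>0; <⇒<ᵇ; <ᵇ⇒<; ≤⇒≤ᵇ; ≤ᵇ⇒≤)
  renaming (_≟_ to _≟ℕ_)
open import Data.Nat.Induction using (<-wellFounded)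
open import Data.Product using (Σ; ∃₂; _×_; _,_; proj₁; proj₂)
open import Data.Sum using (_⊎_; inj₁; inj₂; [_,_])
open import Function using (id; Equivalence)
open import Induction.WellFounded using (Acc; acc)
open import Relation.Nullary using (¬_; yes; no; contradiction)
open import Relation.Nullary.Decidable using (⌊_⌋)
open import Relation.Binary.PropositionalEquality using (_≡_; _≢_; refl; cong; cong₂; subst)
import Relation.Binary.PropositionalEquality as ≡

n≤2*⌈n/2⌉ : ∀ n → n ≤ 2 * ⌈ n /2⌉
n≤2*⌈n/2⌉ zero = z≤n
n≤2*⌈n/2⌉ (suc zero) = s≤s z≤n
n≤2*⌈n/2⌉ (suc (suc n)) =
  subst (2 + n ≤_) (≡.sym (*-suc 2 ⌈ n /2⌉)) (s≤s (s≤s (n≤2*⌈n/2⌉ n)))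

n≤2^⌈log2⌉n : ∀ n (rec : Acc _<_ n) → n ≤ 2 ^ ⌈log2⌉ n rec
n≤2^⌈log2⌉n zero _ = z≤n
n≤2^⌈log2⌉n (suc zero) _ = ≤-refl
n≤2^⌈log2⌉n (suc (suc n)) (acc rs) =
  ≤-trans (n≤2*⌈n/2⌉ (2 + n)) (*-monoʳ-≤ 2 (n≤2^⌈log2⌉n (suc ⌈ n /2⌉) (rs _)))

n≤2^⌈log₂n⌉ : ∀ n → n ≤ 2 ^ ⌈log₂ n ⌉
n≤2^⌈log₂n⌉ n = n≤2^⌈log2⌉n n (<-wellFounded n)

module _ {X : Set} {f g : X → ℕ} where

  sum-map-mono-≤ : (∀ x → f x ≤ g x) → ∀ xs → sum (map f xs) ≤ sum (map g xs)
  sum-map-mono-≤ f≤g [] = z≤n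
  sum-map-mono-≤ f≤g (x ∷ xs) = +-mono-≤ (f≤g x) (sum-map-mono-≤ f≤g xs)

  sum-map-mono-< : (∀ x → f x ≤ g x) → ∀ {x xs} → x ∈ xs → f x < g x →
                   sum (map f xs) < sum (map g xs)
  sum-map-mono-< f≤g {xs = _ ∷ xs} (here refl) fx<gx =
    +-mono-<-≤ fx<gx (sum-map-mono-≤ f≤g xs)
  sum-map-mono-< f≤g {xs = y ∷ _} (there x∈xs) fx<gx =
    +-mono-≤-< (f≤g y) (sum-map-mono-< f≤g x∈xs fx<gx)

module _ {X : Set} (f : X → ℕ) where

  ∈⇒≤sum-map : ∀ {x xs} → x ∈ xs → f x ≤ sum (map f xs)
  ∈⇒≤sum-map {xs = _ ∷ xs} (here refl) = m≤m+n _ (sum (map f xs))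
  ∈⇒≤sum-map {xs = y ∷ _} (there x∈xs) = ≤-trans (∈⇒≤sum-map x∈xs) (m≤n+m _ (f y))

  sum-map>0 : ∀ xs → 0 < sum (map f xs) → Σ X λ x → 0 < f x
  sum-map>0 (x ∷ xs) 0<sum with f x in fx
  ... | zero = sum-map>0 xs 0<sum
  ... | suc _ = x , subst (0 <_) (≡.sym fx) z<s

indicator : Bool → ℕ
indicator b = if b then 1 else 0

indicator-mono-≤ : ∀ {a b} → (a ≡ true → b ≡ true) → indicator a ≤ indicator b
indicator-mono-≤ {false} _ = z≤n
indicator-mono-≤ {true} a⇒b rewrite a⇒b refl = ≤-refl

indicator-mono-< : ∀ {a b} → a ≡ false → b ≡ true → indicator a < indicator b
indicator-mono-< refl refl = z<s

indicator>0 : ∀ {b} → b ≡ true → 0 < indicator b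
indicator>0 refl = z<s

indicator>0⁻ : ∀ b → 0 < indicator b → b ≡ true
indicator>0⁻ true _ = refl

_⊆ᴬ_ : ∀ {n} → Adj n → Adj n → Set
A ⊆ᴬ B = ∀ x y → A x y ≡ true → B x y ≡ true

countPairs : ∀ {n} → Adj n → ℕ
countPairs {n} p = sum (map (λ x → sum (map (λ y → indicator (p x y)) (allFin n))) (allFin n))

module _ {n} {p q : Adj n} where

  countPairs-mono-≤ : p ⊆ᴬ q → countPairs p ≤ countPairs q
  countPairs-mono-≤ p⊆q =
    sum-map-mono-≤ (λ x → sum-map-mono-≤ (λ y → indicator-mono-≤ (p⊆q x y)) (allFin n)) (allFin n)

  countPairs-mono-< : p ⊆ᴬ q → ∀ {a b} → p a b ≡ false → q a b ≡ true → countPairs p < countPairs q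
  countPairs-mono-< p⊆q {a} {b} ¬pab qab =
    sum-map-mono-< (λ x → sum-map-mono-≤ (λ y → indicator-mono-≤ (p⊆q x y)) (allFin n)) (∈-allFin a)
      (sum-map-mono-< (λ y → indicator-mono-≤ (p⊆q a y)) (∈-allFin b) (indicator-mono-< ¬pab qab))

module _ {n} (p : Adj n) where

  countPairs>0 : ∀ {a b} → p a b ≡ true → 0 < countPairs p
  countPairs>0 {a} {b} pab = <-≤-trans (indicator>0 pab)
    (≤-trans (∈⇒≤sum-map (λ y → indicator (p a y)) (∈-allFin b))
             (∈⇒≤sum-map (λ x → sum (map (λ y → indicator (p x y)) (allFin n))) (∈-allFin a)))

  countPairs>0⁻ : 0 < countPairs p → ∃₂ λ a b → p a b ≡ true
  countPairs>0⁻ 0<count with sum-map>0 _ (allFin n) 0<count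
  ... | a , 0<row with sum-map>0 _ (allFin n) 0<row
  ... | b , 0<pab = a , b , indicator>0⁻ (p a b) 0<pab

Symmetricᴬ : ∀ {n} → Adj n → Set
Symmetricᴬ A = ∀ x y → A x y ≡ A y x

module _ {n} (a b : Fin n) (A : Adj n) where

  removeEdge-⊆ : removeEdge a b A ⊆ᴬ A
  removeEdge-⊆ x y = ∧-conicalˡ (A x y) _

  removeEdge-removes : removeEdge a b A a b ≡ false
  removeEdge-removes with a ≟ a | b ≟ b
  ... | yes _ | yes _ = ∧-zeroʳ (A a b)
  ... | no a≢a | _ = contradiction refl a≢a
  ... | _ | no b≢b = contradiction refl b≢b

  removeEdge-symmetric : Symmetricᴬ A → Symmetricᴬ (removeEdge a b A)
  removeEdge-symmetric symA x y =
    cong₂ _∧_ (symA x y) (cong not (swap ⌊ x ≟ a ⌋ ⌊ y ≟ b ⌋ ⌊ x ≟ b ⌋ ⌊ y ≟ a ⌋))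
    where
    swap : ∀ p q r s → (p ∧ q) ∨ (r ∧ s) ≡ (s ∧ r) ∨ (q ∧ p)
    swap p q r s = ≡.trans (∨-comm (p ∧ q) (r ∧ s)) (cong₂ _∨_ (∧-comm r s) (∧-comm p q))

Reach-preserves : ∀ {n} {A : Adj n} (P : Fin n → Set) →
                  (∀ x y → A x y ≡ true → P x → P y) → ∀ {v w} → Reach A v w → P v → P w
Reach-preserves P closed here Pv = Pv
Reach-preserves P closed (step e r) Pv = Reach-preserves P closed r (closed _ _ e Pv)

HerderWins-mono : ∀ {n} {k l} {A : Adj n} {v} → k ≤ l → HerderWins k A v → HerderWins l A v
HerderWins-mono _ (done stuck) = done stuck
HerderWins-mono (s≤s k≤l) (cut a b ab next) =
  cut a b ab λ w w≢v v⇝w → HerderWins-mono k≤l (next w w≢v v⇝w)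

cutSize≤wd : ∀ {n} (G : Graph n) π {i} → 0 < i → i < n → cutSize G π i ≤ wd G π
cutSize≤wd G π {suc j} _ i<n =
  foldr-preservesᵒ {P = cutSize G π (suc j) ≤_}
    (λ x y → [ m≤n⇒m≤n⊔o y , m≤n⇒m≤o⊔n x ]) 0 _
    (inj₂ (Any.map⁺ (Any.applyUpTo⁺ id ≤-refl (<⇒≤ i<n))))

module Crossings {n} (π : Permutation′ n) where

  pos : Fin n → ℕ
  pos x = toℕ (π ⟨$⟩ˡ x)

  pos-injective : ∀ {x y} → pos x ≡ pos y → x ≡ y
  pos-injective {x} {y} eq = begin
    x                 ≡⟨ inverseʳ π ⟨
    π ⟨$⟩ʳ (π ⟨$⟩ˡ x) ≡⟨ cong (π ⟨$⟩ʳ_) (toℕ-injective eq) ⟩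
    π ⟨$⟩ʳ (π ⟨$⟩ˡ y) ≡⟨ inverseʳ π ⟩
    y                 ∎
    where open ≡.≡-Reasoning

  pos<n : ∀ x → pos x < n
  pos<n x = toℕ<n (π ⟨$⟩ˡ x)

  crosses : ℕ → Adj n
  crosses i x y = (pos x <ᵇ i) ∧ (i ≤ᵇ pos y)

  record Crossing (A : Adj n) (i : ℕ) (x y : Fin n) : Set where
    constructor crossing
    field
      edge   : A x y ≡ true
      before : pos x < i
      after  : i ≤ pos y

  crossingEdges : Adj n → ℕ → Adj n
  crossingEdges A i x y = A x y ∧ crosses i x y

  crossings : Adj n → ℕ → ℕ
  crossings A i = countPairs (crossingEdges A i)

  crossingEdges-mono : ∀ {A B} → A ⊆ᴬ B → ∀ i → crossingEdges A i ⊆ᴬ crossingEdges B i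
  crossingEdges-mono {A} A⊆B i x y eq =
    cong₂ _∧_ (A⊆B x y (∧-conicalˡ (A x y) _ eq)) (∧-conicalʳ (A x y) _ eq)

  Crossing⇒crossingEdge : ∀ {A i x y} → Crossing A i x y → crossingEdges A i x y ≡ true
  Crossing⇒crossingEdge (crossing Axy x<i i≤y) = cong₂ _∧_ Axy
    (cong₂ _∧_ (Equivalence.to T-≡ (<⇒<ᵇ x<i)) (Equivalence.to T-≡ (≤⇒≤ᵇ i≤y)))

  crossingEdge⇒Crossing : ∀ A i x y → crossingEdges A i x y ≡ true → Crossing A i x y
  crossingEdge⇒Crossing A i x y eq =
    crossing (∧-conicalˡ (A x y) _ eq)
      (<ᵇ⇒< (pos x) i (Equivalence.from T-≡ (∧-conicalˡ (pos x <ᵇ i) _ crosses-ixy)))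
      (≤ᵇ⇒≤ i (pos y) (Equivalence.from T-≡ (∧-conicalʳ (pos x <ᵇ i) _ crosses-ixy)))
    where crosses-ixy = ∧-conicalʳ (A x y) _ eq

  crossings-mono-≤ : ∀ {A B} → A ⊆ᴬ B → ∀ i → crossings A i ≤ crossings B i
  crossings-mono-≤ A⊆B i = countPairs-mono-≤ (crossingEdges-mono A⊆B i)

  Crossing⇒crossings>0 : ∀ {A i x y} → Crossing A i x y → 0 < crossings A i
  Crossing⇒crossings>0 {A} {i} xy-crosses =
    countPairs>0 (crossingEdges A i) (Crossing⇒crossingEdge xy-crosses)

  crossings≡0⇒¬Crossing : ∀ {A i x y} → crossings A i ≡ 0 → ¬ Crossing A i x y
  crossings≡0⇒¬Crossing none xy-crosses = <⇒≢ (Crossing⇒crossings>0 xy-crosses) (≡.sym none)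

  crossings>0⇒Crossing : ∀ {A i} → 0 < crossings A i → ∃₂ (Crossing A i)
  crossings>0⇒Crossing {A} {i} 0<crossings with countPairs>0⁻ (crossingEdges A i) 0<crossings
  ... | x , y , eq = x , y , crossingEdge⇒Crossing A i x y eq

  removeEdge-crossings-< : ∀ {A i a b} → Crossing A i a b →
                           crossings (removeEdge a b A) i < crossings A i
  removeEdge-crossings-< {A} {i} {a} {b} ab-crosses =
    countPairs-mono-< (crossingEdges-mono (removeEdge-⊆ a b A) i)
      (cong (_∧ crosses i a b) (removeEdge-removes a b A)) (Crossing⇒crossingEdge ab-crosses)

module Herding {n} (G : Graph n) (π : Permutation′ n) {c} (wd≤c : wd G π ≤ c) where

  open Crossings π

  InRange : ℕ → ℕ → Fin n → Set
  InRange lo hi x = lo ≤ pos x × pos x < hi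

  record Confined (lo hi : ℕ) (A : Adj n) (v : Fin n) : Set where
    field
      subgraph  : A ⊆ᴬ adj G
      symmetric : Symmetricᴬ A
      closed    : ∀ x y → A x y ≡ true → InRange lo hi x → InRange lo hi y
      inside    : InRange lo hi v

  open Confined

  Confined-whole : ∀ v → Confined 0 n (adj G) v
  Confined-whole v = record
    { subgraph  = λ _ _ e → e
    ; symmetric = sym G
    ; closed    = λ _ y _ _ → z≤n , pos<n y
    ; inside    = z≤n , pos<n v
    }

  Confined-cut : ∀ {lo hi A v w} a b → Confined lo hi A v → Reach (removeEdge a b A) v w →
                 Confined lo hi (removeEdge a b A) w
  Confined-cut {A = A} a b conf v⇝w = record
    { subgraph  = λ x y e → subgraph conf x y (removeEdge-⊆ a b A x y e)
    ; symmetric = removeEdge-symmetric a b A (symmetric conf)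
    ; closed    = closed′
    ; inside    = Reach-preserves _ closed′ v⇝w (inside conf)
    }
    where
    closed′ = λ x y e → closed conf x y (removeEdge-⊆ a b A x y e)

  -- crossings (adj G) i unfolds to cutSize G π i.
  crossings≤c : ∀ {A} → A ⊆ᴬ adj G → ∀ {i} → 0 < i → i < n → crossings A i ≤ c
  crossings≤c A⊆G {i} 0<i i<n =
    ≤-trans (crossings-mono-≤ A⊆G i) (≤-trans (cutSize≤wd G π 0<i i<n) wd≤c)

  isolated : ∀ {k lo hi A v} → hi ≤ lo + 1 → Confined lo hi A v → HerderWins k A v
  isolated {lo = lo} {hi} {A} {v} hi≤lo+1 conf = done λ w → ¬-not (no-edge w)
    where
    at-lo : ∀ {x} → InRange lo hi x → pos x ≡ lo
    at-lo (lo≤x , x<hi) =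
      ≤-antisym (m<1+n⇒m≤n (<-≤-trans x<hi (≤-trans hi≤lo+1 (≤-reflexive (+-comm lo 1))))) lo≤x
    no-loop : A v v ≢ true
    no-loop vv with ≡.trans (≡.sym (subgraph conf v v vv)) (loopless G v)
    ... | ()
    no-edge : ∀ w → A v w ≢ true
    no-edge w vw = no-loop (subst (λ u → A v u ≡ true) w≡v vw)
      where
      w≡v = pos-injective
        (≡.trans (at-lo (closed conf v w vw (inside conf))) (≡.sym (at-lo (inside conf))))

  Confined-split : ∀ {lo mid hi A v} → lo ≤ mid → mid ≤ hi → crossings A mid ≡ 0 →
                   Confined lo hi A v → Confined lo mid A v ⊎ Confined mid hi A v
  Confined-split {lo} {mid} {hi} {A} {v} lo≤mid mid≤hi none conf with pos v <? mid
  ... | yes v<mid = inj₁ record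
    { subgraph = subgraph conf ; symmetric = symmetric conf
    ; closed = closedˡ ; inside = proj₁ (inside conf) , v<mid }
    where
    closedˡ : ∀ x y → A x y ≡ true → InRange lo mid x → InRange lo mid y
    closedˡ x y xy (lo≤x , x<mid) =
      proj₁ (closed conf x y xy (lo≤x , <-≤-trans x<mid mid≤hi)) ,
      ≰⇒> λ mid≤y → crossings≡0⇒¬Crossing {A} none (crossing xy x<mid mid≤y)
  ... | no v≮mid = inj₂ record
    { subgraph = subgraph conf ; symmetric = symmetric conf
    ; closed = closedʳ ; inside = ≮⇒≥ v≮mid , proj₂ (inside conf) }
    where
    -- crossings only counts edges running from left to right, hence the symmetry.
    closedʳ : ∀ x y → A x y ≡ true → InRange mid hi x → InRange mid hi y
    closedʳ x y xy (mid≤x , x<hi) =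
      ≮⇒≥ (λ y<mid → crossings≡0⇒¬Crossing {A} none (crossing yx y<mid mid≤x)) ,
      proj₂ (closed conf x y xy (≤-trans lo≤mid mid≤x , x<hi))
      where yx = ≡.trans (symmetric conf y x) xy

  clearCrossings : ∀ {lo hi k} mid j →
                   (∀ {A v} → Confined lo hi A v → crossings A mid ≡ 0 → HerderWins k A v) →
                   ∀ {A v} → Confined lo hi A v → crossings A mid ≤ j → HerderWins (j + k) A v
  clearCrossings mid zero whenClear conf ≤0 = whenClear conf (n≤0⇒n≡0 ≤0)
  clearCrossings {k = k} mid (suc j) whenClear {A} conf ≤j with crossings A mid ≟ℕ 0
  ... | yes none = HerderWins-mono (m≤n+m k (suc j)) (whenClear conf none)
  ... | no some with crossings>0⇒Crossing {A} {mid} (n≢0⇒n>0 some)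
  ... | a , b , ab-crosses = cut a b (Crossing.edge ab-crosses) λ w _ v⇝w →
    clearCrossings mid j whenClear (Confined-cut a b conf v⇝w)
      (m<1+n⇒m≤n (<-≤-trans (removeEdge-crossings-< ab-crosses) ≤j))

  -- Splitting at lo + 2 ^ k leaves two intervals of at most 2 ^ k positions each.
  herd : ∀ k {lo hi A v} → hi ≤ lo + 2 ^ k → hi ≤ n → Confined lo hi A v → HerderWins (c * k) A v
  herd zero hi≤lo+1 _ conf = isolated hi≤lo+1 conf
  herd (suc k) {lo} {hi} {A} {v} hi≤lo+2^[1+k] hi≤n conf with hi ≤? lo + 2 ^ k
  ... | yes hi≤mid = HerderWins-mono (*-monoʳ-≤ c (n≤1+n k)) (herd k hi≤mid hi≤n conf)
  ... | no hi≰mid = subst (λ t → HerderWins t A v) (≡.sym (*-suc c k))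
          (clearCrossings mid c halves conf
            (crossings≤c (subgraph conf) {mid} 0<mid (<-≤-trans mid<hi hi≤n)))
    where
    mid = lo + 2 ^ k
    mid<hi : mid < hi
    mid<hi = ≰⇒> hi≰mid
    0<mid : 0 < mid
    0<mid = <-≤-trans (m^n>0 2 k) (m≤n+m _ lo)
    hi≤mid+2^k : hi ≤ mid + 2 ^ k
    hi≤mid+2^k = ≤-trans hi≤lo+2^[1+k] (≤-reflexive (begin
      lo + (2 ^ k + (2 ^ k + 0)) ≡⟨ cong (λ t → lo + (2 ^ k + t)) (+-identityʳ (2 ^ k)) ⟩
      lo + (2 ^ k + 2 ^ k)       ≡⟨ +-assoc lo (2 ^ k) (2 ^ k) ⟨
      mid + 2 ^ k                ∎))
      where open ≡.≡-Reasoning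
    halves : ∀ {A v} → Confined lo hi A v → crossings A mid ≡ 0 → HerderWins (c * k) A v
    halves conf′ none with Confined-split (m≤m+n lo (2 ^ k)) (<⇒≤ mid<hi) none conf′
    ... | inj₁ left = herd k ≤-refl (≤-trans (<⇒≤ mid<hi) hi≤n) left
    ... | inj₂ right = herd k hi≤mid+2^k hi≤n right

mainTheorem10 : ∀ {n} (G : Graph n) (c : ℕ) → IsCutwidth G c →
                  CatAtMost G (c * ⌈log₂ n ⌉)
mainTheorem10 {n} G c ((π , wd≡c) , _) v =
  herd ⌈log₂ n ⌉ (n≤2^⌈log₂n⌉ n) ≤-refl (Confined-whole v)
  where open Herding G π (≤-reflexive wd≡c)
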